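{- Let $q=p^n$ with $p$ prime. Let $V[x]$ be the $\mathbb{F}_q$-vector space of polynomials $f\in\mathbb{F}_q[x]$ of degree at most $q-2$ with $f(0)=0$, and let $A:V[x]\to V[x]$ be the linear map $A(f)(x)=f(x+1)-f(1)$. Then the only possible eigenvalue of $A$ is $1$.
   Context: Polynomials in $V[x]$ are formal polynomials; $f(x+1)$ denotes formal substitution. -}

module Defs where

open import Level using (Level)
open import Data.Nat using (ℕ; zero; suc; _≤_; _∸_)
open import Data.List using (List; []; _∷_; map; foldr; length)
open import Data.List.Relation.Unary.Any using (Any)
open import Data.List.Relation.Unary.AllPairs using (AllPairs)
open import Data.Product using (Σ; _×_)
open import Relation.Nullary using (¬_)
open import Relation.Binary.PropositionalEquality using (_≡_)
open import Algebra.Bundles using (CommutativeRing)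

record IsField {c ℓ : Level} (R : CommutativeRing c ℓ) : Set (c Level.⊔ ℓ) where
  open CommutativeRing R
  field
    0≉1     : ¬ (0# ≈ 1#)
    inverse : ∀ x → ¬ (x ≈ 0#) → Σ Carrier (λ y → x * y ≈ 1#)

record HasCard {c ℓ : Level} (R : CommutativeRing c ℓ) (q : ℕ) : Set (c Level.⊔ ℓ) where
  open CommutativeRing R
  field
    elems    : List Carrier
    len      : length elems ≡ q
    complete : ∀ x → Any (x ≈_) elems
    distinct : AllPairs (λ a b → ¬ (a ≈ b)) elems

module Poly {c ℓ : Level} (R : CommutativeRing c ℓ) where
  open CommutativeRing R

  -- formal polynomials as coefficient lists (constant term first)
  Pol : Set c
  Pol = List Carrier

  coeff : Pol → ℕ → Carrier
  coeff []      _       = 0#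
  coeff (a ∷ f) zero    = a
  coeff (a ∷ f) (suc k) = coeff f k

  _≋_ : Pol → Pol → Set ℓ
  f ≋ g = ∀ k → coeff f k ≈ coeff g k

  _⊕_ : Pol → Pol → Pol
  []      ⊕ g       = g
  (a ∷ f) ⊕ []      = a ∷ f
  (a ∷ f) ⊕ (b ∷ g) = (a + b) ∷ (f ⊕ g)

  _·_ : Carrier → Pol → Pol
  c · f = map (c *_) f

  _⊛_ : Pol → Pol → Pol
  []      ⊛ g = []
  (a ∷ f) ⊛ g = (a · g) ⊕ (0# ∷ (f ⊛ g))

  compose : Pol → Pol → Pol
  compose f g = foldr (λ a acc → (a ∷ []) ⊕ (g ⊛ acc)) [] f

  eval : Pol → Carrier → Carrier
  eval f t = foldr (λ a acc → a + t * acc) 0# f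

  x+1 : Pol
  x+1 = 1# ∷ 1# ∷ []

  InV : ℕ → Pol → Set ℓ
  InV q f = (coeff f 0 ≈ 0#) × (∀ k → suc (q ∸ 2) ≤ k → coeff f k ≈ 0#)

  A : Pol → Pol
  A f = compose f x+1 ⊕ ((- eval f 1#) ∷ [])

  IsEigenvalue : ℕ → Carrier → Set (c Level.⊔ ℓ)
  IsEigenvalue q λ' = Σ Pol (λ f → InV q f × ¬ (∀ k → coeff f k ≈ 0#) × (A f ≋ (λ' · f)))

{-# OPTIONS --safe #-}
-- In the monomial basis, f ↦ f(x + 1) is upper unitriangular: it keeps the
-- degree and the leading coefficient of f.  Subtracting the constant f(1)
-- changes only the constant term, so for a nonzero f with f(0) = 0 the
-- leading coefficient a of f (in degree ≥ 1) is also that of A f.  Comparing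
-- leading coefficients in A f = λ f gives a = λ a, hence λ = 1 as a is
-- invertible.  Finiteness of the field is used only to decide whether a
-- coefficient is zero, i.e. to find the leading one.
module Submission where

open import Defs
open import Level using (Level)
open import Data.Nat using (ℕ; _^_; zero; suc; pred; _≤_; z≤n; s≤s)
open import Data.Nat.Properties using (≤-refl; m≤n⇒m≤1+n; pred-mono-≤)
open import Data.Nat.Primality using (Prime)
open import Relation.Binary.PropositionalEquality using (_≡_)
open import Relation.Binary.Bundles using (Setoid)
open import Algebra.Bundles using (CommutativeRing)
open import Data.List using (List; []; _∷_)
open import Data.List.Relation.Unary.Any using (Any; here; there)
open import Data.List.Relation.Unary.All using (All; _∷_)
open import Data.List.Relation.Unary.AllPairs using (AllPairs; _∷_)
open import Data.Product using (Σ; _×_; _,_)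
open import Data.Sum using (_⊎_; inj₁; inj₂)
open import Relation.Nullary using (¬_; Dec; yes; no)
open import Data.Empty using (⊥-elim)
import Relation.Binary.Reasoning.Setoid as SetoidReasoning

module Enumeration {a ℓ : Level} (S : Setoid a ℓ) where
  open Setoid S

  ∉-distinct : ∀ {x y} {xs : List Carrier} →
               All (λ b → ¬ (x ≈ b)) xs → Any (y ≈_) xs → ¬ (x ≈ y)
  ∉-distinct (x≉b ∷ _)   (here y≈b) x≈y = x≉b (trans x≈y y≈b)
  ∉-distinct (_ ∷ x≉bs) (there y∈xs)     = ∉-distinct x≉bs y∈xs

  distinct-enumeration⇒≈-dec : ∀ {x y} (xs : List Carrier) →
    AllPairs (λ b c → ¬ (b ≈ c)) xs → Any (x ≈_) xs → Any (y ≈_) xs → Dec (x ≈ y)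
  distinct-enumeration⇒≈-dec _ _ (here x≈b) (here y≈b) = yes (trans x≈b (sym y≈b))
  distinct-enumeration⇒≈-dec _ (b≉xs ∷ _) (here x≈b) (there y∈xs) =
    no λ x≈y → ∉-distinct b≉xs y∈xs (trans (sym x≈b) x≈y)
  distinct-enumeration⇒≈-dec _ (b≉xs ∷ _) (there x∈xs) (here y≈b) =
    no λ x≈y → ∉-distinct b≉xs x∈xs (trans (sym y≈b) (sym x≈y))
  distinct-enumeration⇒≈-dec (_ ∷ xs) (_ ∷ distinct) (there x∈xs) (there y∈xs) =
    distinct-enumeration⇒≈-dec xs distinct x∈xs y∈xs

module _ {c ℓ : Level} (F : CommutativeRing c ℓ) where
  open CommutativeRing F hiding (zero)
  open Poly F
  open SetoidReasoning setoid

  HasCard⇒≈-dec : ∀ {q} → HasCard F q → ∀ x y → Dec (x ≈ y)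
  HasCard⇒≈-dec card x y =
    Enumeration.distinct-enumeration⇒≈-dec setoid elems distinct (complete x) (complete y)
    where open HasCard card

  VanishesFrom : ℕ → Pol → Set ℓ
  VanishesFrom d f = ∀ k → d ≤ k → coeff f k ≈ 0#

  VanishesFrom-tail : ∀ {d a f} → VanishesFrom d (a ∷ f) → VanishesFrom (pred d) f
  VanishesFrom-tail {zero}  v k _  = v (suc k) z≤n
  VanishesFrom-tail {suc _} v k le = v (suc k) (s≤s le)

  zero-or-leading : (∀ x → Dec (x ≈ 0#)) → ∀ f → (∀ k → coeff f k ≈ 0#) ⊎
                    Σ ℕ (λ d → ¬ (coeff f d ≈ 0#) × VanishesFrom (suc d) f)
  zero-or-leading _≟0 [] = inj₁ λ _ → refl
  zero-or-leading _≟0 (a ∷ f) with zero-or-leading _≟0 f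
  ... | inj₂ (d , f[d]≉0 , v) = inj₂ (suc d , f[d]≉0 , λ { (suc k) (s≤s le) → v k le })
  ... | inj₁ f≈0 with a ≟0
  ...   | yes a≈0 = inj₁ λ { zero → a≈0 ; (suc k) → f≈0 k }
  ...   | no  a≉0 = inj₂ (zero , a≉0 , λ { (suc k) _ → f≈0 k })

  coeff-⊕ : ∀ f g k → coeff (f ⊕ g) k ≈ coeff f k + coeff g k
  coeff-⊕ []      g       k       = sym (+-identityˡ _)
  coeff-⊕ (a ∷ f) []      zero    = sym (+-identityʳ _)
  coeff-⊕ (a ∷ f) []      (suc k) = sym (+-identityʳ _)
  coeff-⊕ (a ∷ f) (b ∷ g) zero    = refl
  coeff-⊕ (a ∷ f) (b ∷ g) (suc k) = coeff-⊕ f g k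

  coeff-· : ∀ x f k → coeff (x · f) k ≈ x * coeff f k
  coeff-· x []      k       = sym (zeroʳ x)
  coeff-· x (a ∷ f) zero    = refl
  coeff-· x (a ∷ f) (suc k) = coeff-· x f k

  coeff-1· : ∀ f k → coeff (1# · f) k ≈ coeff f k
  coeff-1· f k = trans (coeff-· 1# f k) (*-identityˡ _)

  coeff-1⊛ : ∀ f k → coeff ((1# ∷ []) ⊛ f) k ≈ coeff f k
  coeff-1⊛ f k = begin
    coeff ((1# · f) ⊕ (0# ∷ [])) k        ≈⟨ coeff-⊕ (1# · f) _ k ⟩
    coeff (1# · f) k + coeff (0# ∷ []) k  ≈⟨ +-cong (coeff-1· f k) (coeff-0∷[] k) ⟩
    coeff f k + 0#                        ≈⟨ +-identityʳ _ ⟩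
    coeff f k                             ∎
    where
    coeff-0∷[] : ∀ k → coeff (0# ∷ []) k ≈ 0#
    coeff-0∷[] zero    = refl
    coeff-0∷[] (suc k) = refl

  coeff-x+1⊛-zero : ∀ f → coeff (x+1 ⊛ f) 0 ≈ coeff f 0
  coeff-x+1⊛-zero f = begin
    coeff ((1# · f) ⊕ (0# ∷ ((1# ∷ []) ⊛ f))) 0  ≈⟨ coeff-⊕ (1# · f) _ 0 ⟩
    coeff (1# · f) 0 + 0#                        ≈⟨ +-identityʳ _ ⟩
    coeff (1# · f) 0                             ≈⟨ coeff-1· f 0 ⟩
    coeff f 0                                    ∎

  coeff-x+1⊛-suc : ∀ f k → coeff (x+1 ⊛ f) (suc k) ≈ coeff f (suc k) + coeff f k
  coeff-x+1⊛-suc f k = begin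
    coeff ((1# · f) ⊕ (0# ∷ ((1# ∷ []) ⊛ f))) (suc k)    ≈⟨ coeff-⊕ (1# · f) _ (suc k) ⟩
    coeff (1# · f) (suc k) + coeff ((1# ∷ []) ⊛ f) k     ≈⟨ +-cong (coeff-1· f (suc k)) (coeff-1⊛ f k) ⟩
    coeff f (suc k) + coeff f k                          ∎

  shift : Pol → Pol
  shift f = compose f x+1

  coeff-shift-∷-zero : ∀ a f → coeff (shift (a ∷ f)) 0 ≈ a + coeff (shift f) 0
  coeff-shift-∷-zero a f = trans (coeff-⊕ (a ∷ []) (x+1 ⊛ shift f) 0)
                                 (+-congˡ (coeff-x+1⊛-zero (shift f)))

  coeff-shift-∷-suc : ∀ a f k →
    coeff (shift (a ∷ f)) (suc k) ≈ coeff (shift f) (suc k) + coeff (shift f) k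
  coeff-shift-∷-suc a f k = begin
    coeff (shift (a ∷ f)) (suc k)                ≈⟨ coeff-⊕ (a ∷ []) (x+1 ⊛ shift f) (suc k) ⟩
    0# + coeff (x+1 ⊛ shift f) (suc k)           ≈⟨ +-identityˡ _ ⟩
    coeff (x+1 ⊛ shift f) (suc k)                ≈⟨ coeff-x+1⊛-suc (shift f) k ⟩
    coeff (shift f) (suc k) + coeff (shift f) k  ∎

  shift-VanishesFrom : ∀ f d → VanishesFrom d f → VanishesFrom d (shift f)
  shift-VanishesFrom []      d v k       _  = refl
  shift-VanishesFrom (a ∷ f) d v zero    z≤n = begin
    coeff (shift (a ∷ f)) 0    ≈⟨ coeff-shift-∷-zero a f ⟩
    a + coeff (shift f) 0      ≈⟨ +-cong (v 0 z≤n) (shift-VanishesFrom f 0 (VanishesFrom-tail v) 0 z≤n) ⟩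
    0# + 0#                    ≈⟨ +-identityˡ _ ⟩
    0#                         ∎
  shift-VanishesFrom (a ∷ f) d v (suc k) le = begin
    coeff (shift (a ∷ f)) (suc k)                ≈⟨ coeff-shift-∷-suc a f k ⟩
    coeff (shift f) (suc k) + coeff (shift f) k  ≈⟨ +-cong (vanish (suc k) (m≤n⇒m≤1+n pd≤k)) (vanish k pd≤k) ⟩
    0# + 0#                                      ≈⟨ +-identityˡ _ ⟩
    0#                                           ∎
    where
    vanish = shift-VanishesFrom f (pred d) (VanishesFrom-tail v)
    pd≤k = pred-mono-≤ le

  shift-leading : ∀ f d → VanishesFrom (suc d) f → coeff (shift f) d ≈ coeff f d
  shift-leading []      d       v = refl
  shift-leading (a ∷ f) zero    v = begin
    coeff (shift (a ∷ f)) 0  ≈⟨ coeff-shift-∷-zero a f ⟩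
    a + coeff (shift f) 0    ≈⟨ +-congˡ (shift-VanishesFrom f 0 (VanishesFrom-tail v) 0 z≤n) ⟩
    a + 0#                   ≈⟨ +-identityʳ a ⟩
    a                        ∎
  shift-leading (a ∷ f) (suc d) v = begin
    coeff (shift (a ∷ f)) (suc d)                ≈⟨ coeff-shift-∷-suc a f d ⟩
    coeff (shift f) (suc d) + coeff (shift f) d
      ≈⟨ +-cong (shift-VanishesFrom f (suc d) (VanishesFrom-tail v) (suc d) ≤-refl)
                (shift-leading f d (VanishesFrom-tail v)) ⟩
    0# + coeff f d                               ≈⟨ +-identityˡ _ ⟩
    coeff f d                                    ∎

  coeff-A-suc : ∀ f k → coeff (A f) (suc k) ≈ coeff (shift f) (suc k)
  coeff-A-suc f k = trans (coeff-⊕ (shift f) _ (suc k)) (+-identityʳ _)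

  invertible-fixed⇒≈1 : ∀ {λ' a b} → a * b ≈ 1# → a ≈ λ' * a → λ' ≈ 1#
  invertible-fixed⇒≈1 {λ'} {a} {b} ab≈1 a≈λa = begin
    λ'             ≈⟨ *-identityʳ λ' ⟨
    λ' * 1#        ≈⟨ *-congˡ ab≈1 ⟨
    λ' * (a * b)   ≈⟨ *-assoc λ' a b ⟨
    (λ' * a) * b   ≈⟨ *-congʳ a≈λa ⟨
    a * b          ≈⟨ ab≈1 ⟩
    1#             ∎

  leading-eigen : ∀ {λ'} f d → VanishesFrom (suc (suc d)) f → A f ≋ (λ' · f) →
                  coeff f (suc d) ≈ λ' * coeff f (suc d)
  leading-eigen {λ'} f d v Af≈λf = begin
    coeff f (suc d)          ≈⟨ shift-leading f (suc d) v ⟨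
    coeff (shift f) (suc d)  ≈⟨ coeff-A-suc f d ⟨
    coeff (A f) (suc d)      ≈⟨ Af≈λf (suc d) ⟩
    coeff (λ' · f) (suc d)   ≈⟨ coeff-· λ' f (suc d) ⟩
    λ' * coeff f (suc d)     ∎

  eigenvalue≈1 : ∀ {q} → IsField F → HasCard F q → ∀ λ' → IsEigenvalue q λ' → λ' ≈ 1#
  eigenvalue≈1 isField card λ' (f , (f[0]≈0 , _) , f≉0 , Af≈λf)
    with zero-or-leading (λ x → HasCard⇒≈-dec card x 0#) f
  ... | inj₁ f≈0                 = ⊥-elim (f≉0 f≈0)
  ... | inj₂ (zero , a≉0 , _)    = ⊥-elim (a≉0 f[0]≈0)
  ... | inj₂ (suc d , a≉0 , v)   with IsField.inverse isField (coeff f (suc d)) a≉0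
  ...   | b , ab≈1 = invertible-fixed⇒≈1 ab≈1 (leading-eigen f d v Af≈λf)

lemma2 : {c ℓ : Level} (p n q : ℕ) → Prime p → q ≡ p ^ n →
    (F : CommutativeRing c ℓ) → IsField F → HasCard F q →
    (λ' : CommutativeRing.Carrier F) → Poly.IsEigenvalue F q λ' →
    CommutativeRing._≈_ F λ' (CommutativeRing.1# F)
lemma2 _ _ _ _ _ F isField card = eigenvalue≈1 F isField card
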